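{- Let $\mathbb D=\langle D,\leq_{\mathbb D}\rangle$ be a directed set such that for every countable subset $P\subseteq D$ there is $q\in D$ with $p\leq_{\mathbb D} q$ for all $p\in P$. Then Player I has a winning strategy in $\mathcal G(\mathbb D)$, and hence Player II has no winning strategy in $\mathcal G(\mathbb D)$.
   Context: A directed set is a pair $\langle D,\leq_{\mathbb D}\rangle$ with $\leq_{\mathbb D}$ reflexive and transitive such that any two elements have a common upper bound. The game $\mathcal G(\mathbb D)$: in round $i<\omega$, Player I chooses $p_{2i}\in D$ and then Player II chooses $p_{2i+1}\in D$. Player I wins the run $(p_i)_{i<\omega}$ iff either there is $i$ with $p_{2i}\not\leq_{\mathbb D} p_{2i+1}$, or $p_{2i+1}\leq_{\mathbb D}p_{2i+2}$ for all $i<\omega$ and there is $p\in D$ with $p_i\leq_{\mathbb D} p$ for all $i$. A winning strategy for a player is a function assigning that player's moves from the previous moves such that the player wins every run played according to it; for Player II it is $s:{}^{<\omega}D\to D$ with $p_{2i+1}=s(\langle p_0,\dots,p_{2i}\rangle)$. -}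

module Defs where

open import Level using (Level; _⊔_; suc)
open import Data.Nat using (ℕ; _*_) renaming (suc to sucℕ)
open import Data.List using (List; applyUpTo)
open import Data.Maybe using (Maybe; just)
open import Data.Product using (Σ; ∃; _×_; _,_)
open import Data.Sum using (_⊎_)
open import Relation.Nullary using (¬_)
open import Relation.Binary.PropositionalEquality using (_≡_)

record DirectedSet (c ℓ : Level) : Set (suc (c ⊔ ℓ)) where
  field
    Carrier  : Set c
    _≤_      : Carrier → Carrier → Set ℓ
    ≤-refl   : ∀ {x} → x ≤ x
    ≤-trans  : ∀ {x y z} → x ≤ y → y ≤ z → x ≤ z
    directed : ∀ x y → Σ Carrier λ z → (x ≤ z) × (y ≤ z)

module _ {c ℓ : Level} (𝔻 : DirectedSet c ℓ) where
  open DirectedSet 𝔻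

  -- A subset P ⊆ D (a predicate) is countable if it is enumerated by
  -- some f : ℕ → Maybe D (nothing = "skip"), which covers empty,
  -- finite and countably infinite subsets.
  Countable : ∀ {p} → (Carrier → Set p) → Set (c ⊔ p)
  Countable P = Σ (ℕ → Maybe Carrier) λ f →
    (∀ n d → f n ≡ just d → P d) × (∀ d → P d → ∃ λ n → f n ≡ just d)

  CountablyDirected : (p : Level) → Set (c ⊔ ℓ ⊔ suc p)
  CountablyDirected p = (P : Carrier → Set p) → Countable P →
    Σ Carrier λ q → ∀ x → P x → x ≤ q

  Run : Set c
  Run = ℕ → Carrier

  history : Run → ℕ → List Carrier
  history r n = applyUpTo r n

  PlayerIWins : Run → Set (c ⊔ ℓ)
  PlayerIWins r =
    (∃ λ i → ¬ (r (2 * i) ≤ r (sucℕ (2 * i))))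
    ⊎ ((∀ i → r (sucℕ (2 * i)) ≤ r (sucℕ (sucℕ (2 * i))))
       × Σ Carrier λ q → ∀ i → r i ≤ q)

  Strategy : Set c
  Strategy = List Carrier → Carrier

  FollowsI : Strategy → Run → Set c
  FollowsI σ r = ∀ i → r (2 * i) ≡ σ (history r (2 * i))

  FollowsII : Strategy → Run → Set c
  FollowsII s r = ∀ i → r (sucℕ (2 * i)) ≡ s (history r (sucℕ (2 * i)))

  WinningI : Strategy → Set (c ⊔ ℓ)
  WinningI σ = ∀ r → FollowsI σ r → PlayerIWins r

  WinningII : Strategy → Set (c ⊔ ℓ)
  WinningII s = ∀ r → FollowsII s r → ¬ PlayerIWins r

module Submission where

-- Countable directedness makes every sequence ℕ → D bounded,
-- so Player I wins as soon as the run is a chain at the odd-to-even steps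
-- p_{2i+1} ≤ p_{2i+2}.  Player I forces this by always playing an upper
-- bound of the whole history so far (finite lists have upper bounds in any
-- inhabited directed set, and D is inhabited since the empty set is
-- countable and hence bounded).  The second half is a general fact about
-- the game: any strategy of Player I and any strategy of Player II can be
-- played against each other, producing a run that follows both, so both
-- players cannot have winning strategies at once.

open import Defs
open import Level using (Level; Lift; lift)
open import Data.Product using (Σ; _×_; _,_; proj₁; proj₂)
open import Data.Sum using (inj₂)
open import Data.Empty using (⊥)
open import Data.Maybe using (just; nothing)
open import Data.Nat using (ℕ; zero; suc; _*_; _<_)
open import Data.Nat.Properties using (*-suc; n<1+n)
open import Data.List using (List; []; _∷_; _∷ʳ_)
open import Data.List.Properties using (applyUpTo-∷ʳ)
open import Data.List.Relation.Unary.Any using (here; there)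
open import Data.List.Membership.Propositional using (_∈_)
open import Data.List.Membership.Propositional.Properties using (∈-applyUpTo⁺)
open import Relation.Nullary using (¬_)
open import Relation.Binary.PropositionalEquality
  using (_≡_; refl; sym; trans; cong; cong-app; subst)

module GameFacts {c ℓ : Level} (𝔻 : DirectedSet c ℓ) where
  open DirectedSet 𝔻

  -- The strategy responsible for move n: Player I's on even n, II's on odd n.
  turn : ℕ → Strategy 𝔻 → Strategy 𝔻 → Strategy 𝔻
  turn zero    σ s = σ
  turn (suc n) σ s = turn n s σ

  turn-even : ∀ i σ s → turn (2 * i) σ s ≡ σ
  turn-even zero    σ s = refl
  turn-even (suc i) σ s =
    subst (λ m → turn m σ s ≡ σ) (sym (*-suc 2 i)) (turn-even i σ s)

  turn-odd : ∀ i σ s → turn (suc (2 * i)) σ s ≡ s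
  turn-odd i σ s = turn-even i s σ

  module Match (σ s : Strategy 𝔻) where
    moves : ℕ → List Carrier
    run   : Run 𝔻
    moves zero    = []
    moves (suc n) = moves n ∷ʳ run n
    run n = turn n σ s (moves n)

    moves-history : ∀ n → history 𝔻 run n ≡ moves n
    moves-history zero    = refl
    moves-history (suc n) =
      trans (sym (applyUpTo-∷ʳ run n)) (cong (_∷ʳ run n) (moves-history n))

    follows-I : FollowsI 𝔻 σ run
    follows-I i rewrite moves-history (2 * i) =
      cong-app (turn-even i σ s) (moves (2 * i))

    follows-II : FollowsII 𝔻 s run
    follows-II i rewrite moves-history (suc (2 * i)) =
      cong-app (turn-odd i σ s) (moves (suc (2 * i)))

  -- At most one player has a winning strategy: play them against each other.
  winningI⇒¬winningII : Σ (Strategy 𝔻) (WinningI 𝔻) → ¬ Σ (Strategy 𝔻) (WinningII 𝔻)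
  winningI⇒¬winningII (σ , σ-wins) (s , s-wins) =
    s-wins run follows-II (σ-wins run follows-I)
    where open Match σ s

module FiniteBounds {c ℓ : Level} (𝔻 : DirectedSet c ℓ) where
  open DirectedSet 𝔻

  upperBound : Carrier → List Carrier → Carrier
  upperBound d []       = d
  upperBound d (x ∷ xs) = proj₁ (directed x (upperBound d xs))

  upperBound-≥ : ∀ d {x xs} → x ∈ xs → x ≤ upperBound d xs
  upperBound-≥ d {xs = y ∷ ys} (here refl) = proj₁ (proj₂ (directed y _))
  upperBound-≥ d {xs = y ∷ ys} (there x∈ys) =
    ≤-trans (upperBound-≥ d x∈ys) (proj₂ (proj₂ (directed y _)))

module CountablyDirectedGame {c ℓ : Level} (𝔻 : DirectedSet c ℓ)
                             (cd : CountablyDirected 𝔻 c) where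
  open DirectedSet 𝔻
  open FiniteBounds 𝔻

  -- The empty set is countable, so it has a bound: D is inhabited.
  inhabitant : Carrier
  inhabitant = proj₁ (cd (λ _ → Lift c ⊥)
    ((λ _ → nothing) , (λ { _ _ () }) , (λ { _ (lift ()) })))

  -- The range of a sequence is countable, hence bounded.
  sequence-bounded : (r : ℕ → Carrier) → Σ Carrier λ q → ∀ i → r i ≤ q
  sequence-bounded r = q , λ i → q-bounds (r i) (i , refl)
    where
    range : Carrier → Set c
    range x = Σ ℕ λ i → r i ≡ x
    range-countable : Countable 𝔻 range
    range-countable =
      (λ n → just (r n)) , (λ { n _ refl → n , refl }) , (λ { _ (i , refl) → i , refl })
    range-bounded : Σ Carrier λ q → ∀ x → range x → x ≤ q
    range-bounded = cd range range-countable
    q : Carrier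
    q = proj₁ range-bounded
    q-bounds : ∀ x → range x → x ≤ q
    q-bounds = proj₂ range-bounded

  boundingStrategy : Strategy 𝔻
  boundingStrategy = upperBound inhabitant

  earlier-≤-bound : ∀ r → FollowsI 𝔻 boundingStrategy r →
                    ∀ i k → k < 2 * i → r k ≤ r (2 * i)
  earlier-≤-bound r follows i k k<2i =
    subst (r k ≤_) (sym (follows i)) (upperBound-≥ inhabitant (∈-applyUpTo⁺ r k<2i))

  boundingStrategy-wins : WinningI 𝔻 boundingStrategy
  boundingStrategy-wins r follows = inj₂ (chain , sequence-bounded r)
    where
    chain : ∀ i → r (suc (2 * i)) ≤ r (suc (suc (2 * i)))
    chain i = subst (λ m → r (suc (2 * i)) ≤ r m) (*-suc 2 i)
      (earlier-≤-bound r follows (suc i) (suc (2 * i))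
        (subst (suc (2 * i) <_) (sym (*-suc 2 i)) (n<1+n _)))

proposition4p3 : ∀ {c ℓ : Level} (𝔻 : DirectedSet c ℓ) →
    CountablyDirected 𝔻 c →
    Σ (Strategy 𝔻) (WinningI 𝔻) × ¬ Σ (Strategy 𝔻) (WinningII 𝔻)
proposition4p3 𝔻 cd = winningI , GameFacts.winningI⇒¬winningII 𝔻 winningI
  where
  open CountablyDirectedGame 𝔻 cd
  winningI : Σ (Strategy 𝔻) (WinningI 𝔻)
  winningI = boundingStrategy , boundingStrategy-wins
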